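{- Let $l\geqslant 1$ be an integer and let $n\geqslant l+4$ be an integer. Then $$\kappa_l(n,4)=\begin{cases}\lfloor (n+l)/2\rfloor, & l+4\leqslant n<2l;\\ \lfloor (3n+6l)/8\rfloor, & \max\{2l,l+4\}\leqslant n<6l;\\ \lfloor (n+6l)/4\rfloor, & n\geqslant 6l.\end{cases}$$
   Context: For a positive integer $n$, $[n]=\{1,\ldots,n\}$. A family $\mathcal{F}$ of subsets of $[n]$ is an $m$-family if it has $m$ members (required to be pairwise distinct subsets); it is $k$-uniform if every member has size $k$; for a set $L$ of nonnegative integers it is $L$-intersecting if $|F\cap F'|\in L$ for every two distinct members $F,F'$. $\kappa_{L}(n,m)$ denotes the maximum $k$ such that there exists a $k$-uniform $L$-intersecting $m$-family of subsets of $[n]$ (and $-\infty$ if none exists), and $\kappa_l(n,m)$ denotes $\kappa_{\{l\}}(n,m)$. -}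

module Defs where

open import Data.Nat using (ℕ; _+_; _*_; _≤_; _<_; _≥_)
open import Data.Nat.DivMod using (_/_)
open import Data.Fin using (Fin)
open import Data.Fin.Subset using (Subset; ∣_∣; _∩_)
open import Data.Product using (_×_; Σ; ∃)
open import Relation.Binary.PropositionalEquality using (_≡_; _≢_)
open import Relation.Nullary using (¬_)

Family : ℕ → ℕ → Set
Family n m = Fin m → Subset n

Distinct : ∀ {n m} → Family n m → Set
Distinct {m = m} F = (i j : Fin m) → i ≢ j → F i ≢ F j

Uniform : ∀ {n m} → ℕ → Family n m → Set
Uniform {m = m} k F = (i : Fin m) → ∣ F i ∣ ≡ k

Intersecting : ∀ {n m} → (ℕ → Set) → Family n m → Set
Intersecting {m = m} L F = (i j : Fin m) → i ≢ j → L ∣ F i ∩ F j ∣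

Realizable : (ℕ → Set) → ℕ → ℕ → ℕ → Set
Realizable L n m k =
  Σ (Family n m) λ F → Distinct F × Uniform k F × Intersecting L F

IsKappa : (ℕ → Set) → ℕ → ℕ → ℕ → Set
IsKappa L n m k = Realizable L n m k × (∀ k' → Realizable L n m k' → k' ≤ k)

Single : ℕ → ℕ → Set
Single l x = x ≡ l

module Submission where

open import Defs
open import Data.Nat using (ℕ; _+_; _*_; _≤_; _<_; _≥_)
open import Data.Nat.DivMod using (_/_)
open import Data.Product using (_×_)

open import Algebra.Properties.CommutativeMonoid.Sum as Sum using ()
open import Data.Bool using (Bool; true; false; _∧_)
open import Data.Empty using (⊥-elim)
open import Data.Fin using (Fin)
open import Data.Fin.Patterns using (0F; 1F; 2F; 3F; 4F; 5F)
open import Data.Fin.Properties using (all?) renaming (_≟_ to _≟ᶠ_)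
open import Data.Fin.Subset using (Subset; ∣_∣; _∩_)
open import Data.Fin.Subset.Properties using (∩-idem)
open import Data.Nat using (zero; suc; z≤n; s≤s; NonZero; _≤?_)
open import Data.Nat.Combinatorics using (_C_)
open import Data.Nat.DivMod using (_%_; /-monoˡ-≤; m*n/n≡m; m<n⇒m/n≡0; +-distrib-/-∣ʳ; m≡m%n+[m/n]*n; m%n<n)
open import Data.Nat.Divisibility using (divides)
open import Data.Nat.Properties
open import Data.Nat.Tactic.RingSolver using (solve-∀)
open import Data.Product using (Σ; _,_; proj₁; proj₂)
open import Data.Vec using (Vec; []; _∷_; _++_; lookup)
open import Data.Vec.Properties using (lookup-zipWith; zipWith-++)
open import Function using (_∘_)
open import Relation.Binary.PropositionalEquality
open import Relation.Nullary.Decidable using (Dec; yes; no; ¬?; _→-dec_; True; toWitness)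

open Sum +-0-commutativeMonoid using (sum-syntax; sum-cong-≗; ∑-comm)

-- Upper bounds, by weighted double counting.  Record for each point of [n]
-- the set of members of a 4-family containing it.  A point lying in h
-- members contributes h to Σ|Fᵢ| = 4k and C(h,2) to Σ_{i<j}|Fᵢ ∩ Fⱼ| = 6l.
-- If a·h ≤ b + C(h,2) for all h ≤ 4, summing over the points gives
-- 4ak ≤ bn + 6l; the weights (3,6), (2,3), (1,1) give the three bounds
-- 2k ≤ n + l, 8k ≤ 3n + 6l and 4k ≤ n + 6l.
--
-- Lower bounds, by construction.  "Designs" (families that are uniform and
-- equi-intersecting, not yet required distinct) add up under disjoint
-- union.  Six small designs, certified by evaluation, are combined with
-- multiplicities chosen from n and l: explicitly in the ranges n < 2l and
-- n ≥ 6l, and by induction on l in the middle range, where adding a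
-- pair-block or a triple-block keeps the value ⌊(3n + 6l)/8⌋ exact.
-- In every range this value exceeds l, which makes the members distinct.

𝟙 : Bool → ℕ
𝟙 true  = 1
𝟙 false = 0

𝟙≤1 : ∀ b → 𝟙 b ≤ 1
𝟙≤1 true  = s≤s z≤n
𝟙≤1 false = z≤n

∣s∣≡∑𝟙 : ∀ {n} (s : Subset n) → ∣ s ∣ ≡ ∑[ x < n ] 𝟙 (lookup s x)
∣s∣≡∑𝟙 []          = refl
∣s∣≡∑𝟙 (true ∷ s)  = cong suc (∣s∣≡∑𝟙 s)
∣s∣≡∑𝟙 (false ∷ s) = ∣s∣≡∑𝟙 s

double-count : ∀ {m n} (S : Fin m → Subset n) →
  ∑[ j < m ] ∣ S j ∣ ≡ ∑[ x < n ] ∑[ j < m ] 𝟙 (lookup (S j) x)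
double-count {m} {n} S = trans (sum-cong-≗ (λ j → ∣s∣≡∑𝟙 (S j))) (∑-comm {m} {n} (λ j x → 𝟙 (lookup (S j) x)))

∑-affine : ∀ a b {n} (f g : Fin n → ℕ) → (∀ x → a * f x ≤ b + g x) →
  a * ∑[ x < n ] f x ≤ b * n + ∑[ x < n ] g x
∑-affine a b {zero}  f g bound = subst (_≤ b * 0 + 0) (sym (*-zeroʳ a)) z≤n
∑-affine a b {suc n} f g bound = begin
  a * (f 0F + ∑f)          ≡⟨ *-distribˡ-+ a (f 0F) ∑f ⟩
  a * f 0F + a * ∑f        ≤⟨ +-mono-≤ (bound 0F) (∑-affine a b (f ∘ Fin.suc) (g ∘ Fin.suc) (bound ∘ Fin.suc)) ⟩
  (b + g 0F) + (b * n + ∑g) ≡⟨ regroup b (g 0F) n ∑g ⟩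
  b * suc n + (g 0F + ∑g)  ∎
  where
  open ≤-Reasoning
  ∑f = ∑[ x < n ] f (Fin.suc x)
  ∑g = ∑[ x < n ] g (Fin.suc x)
  regroup : ∀ b g n s → (b + g) + (b * n + s) ≡ b * suc n + (g + s)
  regroup = solve-∀

-- The type of a point with respect to a family of four sets: which members
-- contain it.
Point : Set
Point = Fin 4 → Bool

pointOf : ∀ {n} → Family n 4 → Fin n → Point
pointOf F x i = lookup (F i) x

pair : Fin 6 → Fin 4 × Fin 4
pair 0F = 0F , 1F
pair 1F = 0F , 2F
pair 2F = 0F , 3F
pair 3F = 1F , 2F
pair 4F = 1F , 3F
pair 5F = 2F , 3F

pair-distinct : ∀ π → proj₁ (pair π) ≢ proj₂ (pair π)
pair-distinct 0F ()
pair-distinct 1F ()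
pair-distinct 2F ()
pair-distinct 3F ()
pair-distinct 4F ()
pair-distinct 5F ()

degree : Point → ℕ
degree p = ∑[ i < 4 ] 𝟙 (p i)

codegree : Point → ℕ
codegree p = ∑[ π < 6 ] 𝟙 (p (proj₁ (pair π)) ∧ p (proj₂ (pair π)))

degree≤4 : ∀ p → degree p ≤ 4
degree≤4 p =
  +-mono-≤ (𝟙≤1 (p 0F)) (+-mono-≤ (𝟙≤1 (p 1F)) (+-mono-≤ (𝟙≤1 (p 2F)) (+-mono-≤ (𝟙≤1 (p 3F)) z≤n)))

codegree≡degreeC2 : ∀ p → codegree p ≡ degree p C 2
codegree≡degreeC2 p with p 0F | p 1F | p 2F | p 3F
... | true  | true  | true  | true  = refl
... | true  | true  | true  | false = refl
... | true  | true  | false | true  = refl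
... | true  | true  | false | false = refl
... | true  | false | true  | true  = refl
... | true  | false | true  | false = refl
... | true  | false | false | true  = refl
... | true  | false | false | false = refl
... | false | true  | true  | true  = refl
... | false | true  | true  | false = refl
... | false | true  | false | true  = refl
... | false | true  | false | false = refl
... | false | false | true  | true  = refl
... | false | false | true  | false = refl
... | false | false | false | true  = refl
... | false | false | false | false = refl

Admissible : ℕ → ℕ → Set
Admissible a b = ∀ h → h ≤ 4 → a * h ≤ b + h C 2

weighted-bound : ∀ a b {n k l} → Admissible a b → Realizable (Single l) n 4 k →
  a * (4 * k) ≤ b * n + 6 * l
weighted-bound a b {n} {k} {l} admissible (F , _ , uniform , intersecting) = begin
  a * (4 * k)                               ≡⟨ cong (a *_) sizes ⟩
  a * ∑[ x < n ] degree (pointOf F x)       ≤⟨ ∑-affine a b _ _ pointwise ⟩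
  b * n + ∑[ x < n ] codegree (pointOf F x) ≡⟨ cong (b * n +_) intersections ⟩
  b * n + 6 * l                             ∎
  where
  open ≤-Reasoning
  sizes : 4 * k ≡ ∑[ x < n ] degree (pointOf F x)
  sizes = trans (sym (sum-cong-≗ uniform)) (double-count F)

  meet : Fin 6 → Subset n
  meet π = F (proj₁ (pair π)) ∩ F (proj₂ (pair π))

  intersections : ∑[ x < n ] codegree (pointOf F x) ≡ 6 * l
  intersections = begin-equality
    ∑[ x < n ] codegree (pointOf F x)
      ≡⟨ sum-cong-≗ {n} (λ x → sum-cong-≗ {6} (λ π →
           cong 𝟙 (sym (lookup-zipWith _∧_ x (F (proj₁ (pair π))) (F (proj₂ (pair π))))))) ⟩
    ∑[ x < n ] ∑[ π < 6 ] 𝟙 (lookup (meet π) x)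
      ≡⟨ sym (double-count meet) ⟩
    ∑[ π < 6 ] ∣ meet π ∣
      ≡⟨ sum-cong-≗ (λ π → intersecting _ _ (pair-distinct π)) ⟩
    6 * l ∎

  pointwise : ∀ x → a * degree (pointOf F x) ≤ b + codegree (pointOf F x)
  pointwise x = subst (λ c → a * degree p ≤ b + c) (sym (codegree≡degreeC2 p))
                      (admissible (degree p) (degree≤4 p))
    where p = pointOf F x

admissible-3-6 : Admissible 3 6
admissible-3-6 0 _ = ≤ᵇ⇒≤ _ _ _
admissible-3-6 1 _ = ≤ᵇ⇒≤ _ _ _
admissible-3-6 2 _ = ≤ᵇ⇒≤ _ _ _
admissible-3-6 3 _ = ≤ᵇ⇒≤ _ _ _
admissible-3-6 4 _ = ≤ᵇ⇒≤ _ _ _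
admissible-3-6 (suc (suc (suc (suc (suc _))))) (s≤s (s≤s (s≤s (s≤s ()))))

admissible-2-3 : Admissible 2 3
admissible-2-3 0 _ = ≤ᵇ⇒≤ _ _ _
admissible-2-3 1 _ = ≤ᵇ⇒≤ _ _ _
admissible-2-3 2 _ = ≤ᵇ⇒≤ _ _ _
admissible-2-3 3 _ = ≤ᵇ⇒≤ _ _ _
admissible-2-3 4 _ = ≤ᵇ⇒≤ _ _ _
admissible-2-3 (suc (suc (suc (suc (suc _))))) (s≤s (s≤s (s≤s (s≤s ()))))

admissible-1-1 : Admissible 1 1
admissible-1-1 0 _ = ≤ᵇ⇒≤ _ _ _
admissible-1-1 1 _ = ≤ᵇ⇒≤ _ _ _
admissible-1-1 2 _ = ≤ᵇ⇒≤ _ _ _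
admissible-1-1 3 _ = ≤ᵇ⇒≤ _ _ _
admissible-1-1 4 _ = ≤ᵇ⇒≤ _ _ _
admissible-1-1 (suc (suc (suc (suc (suc _))))) (s≤s (s≤s (s≤s (s≤s ()))))

≤-floor : ∀ d k x .{{_ : NonZero d}} → d * k ≤ x → k ≤ x / d
≤-floor d k x dk≤x =
  subst (_≤ x / d) (m*n/n≡m k d) (/-monoˡ-≤ d (subst (_≤ x) (*-comm d k) dk≤x))

upper₁ : ∀ {n k l} → Realizable (Single l) n 4 k → k ≤ (n + l) / 2
upper₁ {n} {k} {l} R = ≤-floor 2 k (n + l) (*-cancelˡ-≤ 6
  (subst₂ _≤_ (regroup k) (sym (*-distribˡ-+ 6 n l)) (weighted-bound 3 6 admissible-3-6 R)))
  where
  regroup : ∀ k → 3 * (4 * k) ≡ 6 * (2 * k)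
  regroup = solve-∀

upper₂ : ∀ {n k l} → Realizable (Single l) n 4 k → k ≤ (3 * n + 6 * l) / 8
upper₂ {n} {k} {l} R = ≤-floor 8 k (3 * n + 6 * l) (subst (_≤ 3 * n + 6 * l) (sym (*-assoc 2 4 k)) (weighted-bound 2 3 admissible-2-3 R))

upper₃ : ∀ {n k l} → Realizable (Single l) n 4 k → k ≤ (n + 6 * l) / 4
upper₃ {n} {k} {l} R = ≤-floor 4 k (n + 6 * l)
  (subst₂ (λ m m′ → m ≤ m′ + 6 * l) (*-identityˡ (4 * k)) (*-identityˡ n) (weighted-bound 1 1 admissible-1-1 R))

Design : ℕ → ℕ → ℕ → ℕ → Set
Design m n k l = Σ (Family n m) λ F → Uniform k F × Intersecting (Single l) F

-- Members of size k > l are automatically distinct, since |F ∩ F| = |F|.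
realize : ∀ {m n k l} → Design m n k l → l < k → Realizable (Single l) n m k
realize (F , uniform , intersecting) l<k =
  F , distinct , uniform , intersecting
  where
  distinct : Distinct F
  distinct i j i≢j Fi≡Fj = >⇒≢ l<k (begin
    _                 ≡⟨ sym (uniform i) ⟩
    ∣ F i ∣           ≡⟨ cong ∣_∣ (sym (∩-idem (F i))) ⟩
    ∣ F i ∩ F i ∣     ≡⟨ cong (λ s → ∣ F i ∩ s ∣) Fi≡Fj ⟩
    ∣ F i ∩ F j ∣     ≡⟨ intersecting i j i≢j ⟩
    _                 ∎)
    where open ≡-Reasoning

cast : ∀ {m n n′ k k′ l l′} → n ≡ n′ → k ≡ k′ → l ≡ l′ → Design m n k l → Design m n′ k′ l′
cast refl refl refl D = D

∣∣-++ : ∀ {a b} (s : Subset a) (t : Subset b) → ∣ s ++ t ∣ ≡ ∣ s ∣ + ∣ t ∣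
∣∣-++ []          t = refl
∣∣-++ (true ∷ s)  t = cong suc (∣∣-++ s t)
∣∣-++ (false ∷ s) t = ∣∣-++ s t

_⊕_ : ∀ {m n n′ k k′ l l′} → Design m n k l → Design m n′ k′ l′ → Design m (n + n′) (k + k′) (l + l′)
(F , uF , iF) ⊕ (G , uG , iG) = (λ i → F i ++ G i) , uniform , intersecting
  where
  uniform : Uniform _ (λ i → F i ++ G i)
  uniform i = trans (∣∣-++ (F i) (G i)) (cong₂ _+_ (uF i) (uG i))
  intersecting : Intersecting (Single _) (λ i → F i ++ G i)
  intersecting i j i≢j = begin
    ∣ (F i ++ G i) ∩ (F j ++ G j) ∣       ≡⟨ cong ∣_∣ (zipWith-++ _∧_ (F i) (G i) (F j) (G j)) ⟩
    ∣ (F i ∩ F j) ++ (G i ∩ G j) ∣        ≡⟨ ∣∣-++ (F i ∩ F j) (G i ∩ G j) ⟩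
    ∣ F i ∩ F j ∣ + ∣ G i ∩ G j ∣         ≡⟨ cong₂ _+_ (iF i j i≢j) (iG i j i≢j) ⟩
    _                                     ∎
    where open ≡-Reasoning

infixr 5 _⊕_

∅ : ∀ {m} → Design m 0 0 0
∅ = (λ _ → []) , (λ _ → refl) , (λ _ _ _ → refl)

copies : ∀ {m n k l} c → Design m n k l → Design m (c * n) (c * k) (c * l)
copies zero    D = ∅
copies (suc c) D = D ⊕ copies c D

uniform? : ∀ {m n} k (F : Family n m) → Dec (Uniform k F)
uniform? k F = all? (λ i → ∣ F i ∣ ≟ k)

intersecting? : ∀ {m n} l (F : Family n m) → Dec (Intersecting (Single l) F)
intersecting? l F = all? λ i → all? λ j → ¬? (i ≟ᶠ j) →-dec (∣ F i ∩ F j ∣ ≟ l)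

certified : ∀ {m n k l} (F : Family n m) → {True (uniform? k F)} → {True (intersecting? l F)} →
  Design m n k l
certified F {u} {c} = F , toWitness u , toWitness c

-- The building blocks, written as incidence matrices (rows are the four
-- members, columns the points).
pattern ■ = true
pattern □ = false

matrix : ∀ {n} → Vec (Subset n) 4 → Family n 4
matrix = lookup

pairPoints : Design 4 6 3 1
pairPoints = certified (matrix
  ( (■ ∷ ■ ∷ ■ ∷ □ ∷ □ ∷ □ ∷ [])
  ∷ (■ ∷ □ ∷ □ ∷ ■ ∷ ■ ∷ □ ∷ [])
  ∷ (□ ∷ ■ ∷ □ ∷ ■ ∷ □ ∷ ■ ∷ [])
  ∷ (□ ∷ □ ∷ ■ ∷ □ ∷ ■ ∷ ■ ∷ [])
  ∷ []))

triplePoints : Design 4 4 3 2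
triplePoints = certified (matrix
  ( (□ ∷ ■ ∷ ■ ∷ ■ ∷ [])
  ∷ (■ ∷ □ ∷ ■ ∷ ■ ∷ [])
  ∷ (■ ∷ ■ ∷ □ ∷ ■ ∷ [])
  ∷ (■ ∷ ■ ∷ ■ ∷ □ ∷ [])
  ∷ []))

singlePoints : Design 4 4 1 0
singlePoints = certified (matrix
  ( (■ ∷ □ ∷ □ ∷ □ ∷ [])
  ∷ (□ ∷ ■ ∷ □ ∷ □ ∷ [])
  ∷ (□ ∷ □ ∷ ■ ∷ □ ∷ [])
  ∷ (□ ∷ □ ∷ □ ∷ ■ ∷ [])
  ∷ []))

fullPoint : Design 4 1 1 1
fullPoint = certified (matrix ((■ ∷ []) ∷ (■ ∷ []) ∷ (■ ∷ []) ∷ (■ ∷ []) ∷ []))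

emptyPoint : Design 4 1 0 0
emptyPoint = certified (matrix ((□ ∷ []) ∷ (□ ∷ []) ∷ (□ ∷ []) ∷ (□ ∷ []) ∷ []))

-- a sporadic design on ten points, needed only for (n, l) = (10, 2), (11, 2)
tenPoints : Design 4 10 5 2
tenPoints = certified (matrix
  ( (■ ∷ ■ ∷ ■ ∷ ■ ∷ ■ ∷ □ ∷ □ ∷ □ ∷ □ ∷ □ ∷ [])
  ∷ (■ ∷ ■ ∷ □ ∷ □ ∷ □ ∷ ■ ∷ ■ ∷ ■ ∷ □ ∷ □ ∷ [])
  ∷ (■ ∷ □ ∷ ■ ∷ □ ∷ □ ∷ ■ ∷ □ ∷ □ ∷ ■ ∷ ■ ∷ [])
  ∷ (□ ∷ ■ ∷ □ ∷ ■ ∷ □ ∷ □ ∷ ■ ∷ □ ∷ ■ ∷ ■ ∷ [])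
  ∷ []))

quotient : ∀ d q r x .{{_ : NonZero d}} → r < d → q * d + r ≡ x → x / d ≡ q
quotient d q r x r<d refl = begin
  (q * d + r) / d   ≡⟨ cong (_/ d) (+-comm (q * d) r) ⟩
  (r + q * d) / d   ≡⟨ +-distrib-/-∣ʳ r (divides q refl) ⟩
  r / d + q * d / d ≡⟨ cong₂ _+_ (m<n⇒m/n≡0 r<d) (m*n/n≡m q d) ⟩
  q                 ∎
  where open ≡-Reasoning

-- First range, n < 2l.  Write n - l = 2t + z with z < 2 and l = 2t + w:
-- t triple-blocks, w full points and z empty points have
-- k = 3t + w = ⌊(n + l)/2⌋.
lower₁ : ∀ {l n} → l ≤ n → n < 2 * l → Design 4 n ((n + l) / 2) l
lower₁ {l} l≤n n<2l with m≤n⇒∃[o]m+o≡n l≤n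
... | d , refl = split d (+-cancelˡ-< l d l (subst (λ m → l + d < l + m) (+-identityʳ l) n<2l))
  where
  split : ∀ d → d < l → Design 4 (l + d) ((l + d + l) / 2) l
  split d d<l with d / 2 | d % 2 | m≡m%n+[m/n]*n d 2 | m%n<n d 2
  ... | t | z | refl | z<2 with m≤n⇒∃[o]m+o≡n (≤-trans (m≤n+m (t * 2) z) (<⇒≤ d<l))
  ...   | w , refl = cast (size t w z) (sym (quotient 2 _ z _ z<2 (value t w z))) (height t w z)
                          (copies t triplePoints ⊕ copies w fullPoint ⊕ copies z emptyPoint)
    where
    size : ∀ t w z → t * 4 + (w * 1 + z * 1) ≡ t * 2 + w + (z + t * 2)
    size = solve-∀
    value : ∀ t w z → (t * 3 + (w * 1 + z * 0)) * 2 + z ≡ t * 2 + w + (z + t * 2) + (t * 2 + w)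
    value = solve-∀
    height : ∀ t w z → t * 2 + (w * 1 + z * 0) ≡ t * 2 + w
    height = solve-∀

-- Third range, n ≥ 6l.  Write n - 6l = 4q + r with r < 4: l pair-blocks,
-- q single-blocks and r empty points have k = 3l + q = ⌊(n + 6l)/4⌋.
lower₃ : ∀ {l n} → 6 * l ≤ n → Design 4 n ((n + 6 * l) / 4) l
lower₃ {l} 6l≤n with m≤n⇒∃[o]m+o≡n 6l≤n
... | m , refl with m / 4 | m % 4 | m≡m%n+[m/n]*n m 4 | m%n<n m 4
...   | q | r | refl | r<4 = cast (size l q r) (sym (quotient 4 _ r _ r<4 (value l q r))) (height l q r)
                              (copies l pairPoints ⊕ copies q singlePoints ⊕ copies r emptyPoint)
  where
  size : ∀ l q r → l * 6 + (q * 4 + r * 1) ≡ 6 * l + (r + q * 4)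
  size = solve-∀
  value : ∀ l q r → (l * 3 + (q * 1 + r * 0)) * 4 + r ≡ 6 * l + (r + q * 4) + 6 * l
  value = solve-∀
  height : ∀ l q r → l * 1 + (q * 0 + r * 0) ≡ l
  height = solve-∀

Middle : ℕ → ℕ → Set
Middle l a = Design 4 (2 * l + a) ((3 * (2 * l + a) + 6 * l) / 8) l

/8-shift : ∀ x → (x + 24) / 8 ≡ 3 + x / 8
/8-shift x = trans (+-distrib-/-∣ʳ x (divides 3 refl)) (+-comm (x / 8) 3)

addPairs : ∀ {l a} → Middle l a → Middle (suc l) (4 + a)
addPairs {l} {a} D =
  cast (size l a) (trans (sym (/8-shift (3 * (2 * l + a) + 6 * l))) (cong (_/ 8) (value l a))) refl
       (pairPoints ⊕ D)
  where
  size : ∀ l a → 6 + (2 * l + a) ≡ 2 * suc l + (4 + a)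
  size = solve-∀
  value : ∀ l a → 3 * (2 * l + a) + 6 * l + 24 ≡ 3 * (2 * suc l + (4 + a)) + 6 * suc l
  value = solve-∀

addTriples : ∀ {l a} → Middle l a → Middle (2 + l) a
addTriples {l} {a} D =
  cast (size l a) (trans (sym (/8-shift (3 * (2 * l + a) + 6 * l))) (cong (_/ 8) (value l a))) refl
       (triplePoints ⊕ D)
  where
  size : ∀ l a → 4 + (2 * l + a) ≡ 2 * (2 + l) + a
  size = solve-∀
  value : ∀ l a → 3 * (2 * l + a) + 6 * l + 24 ≡ 3 * (2 * (2 + l) + a) + 6 * (2 + l)
  value = solve-∀

-- The starting values l = 2 (n = 4, …, 11) and l = 3 (n = 6, …, 9).  The
-- point (l, n) = (1, 4) admits no design of this value, so l = 3 is not
-- reduced to l = 1.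
middle₂ : ∀ a → a < 8 → Middle 2 a
middle₂ 0 _ = triplePoints
middle₂ 1 _ = triplePoints ⊕ emptyPoint
middle₂ 2 _ = fullPoint ⊕ fullPoint ⊕ singlePoints
middle₂ 3 _ = pairPoints ⊕ fullPoint
middle₂ 4 _ = triplePoints ⊕ singlePoints
middle₂ 5 _ = triplePoints ⊕ singlePoints ⊕ emptyPoint
middle₂ 6 _ = tenPoints
middle₂ 7 _ = tenPoints ⊕ emptyPoint
middle₂ (suc (suc (suc (suc (suc (suc (suc (suc a)))))))) a<8 = ⊥-elim (m+n≮m 8 a a<8)

middle₃ : ∀ a → a < 4 → Middle 3 a
middle₃ 0 _ = triplePoints ⊕ fullPoint ⊕ emptyPoint
middle₃ 1 _ = fullPoint ⊕ fullPoint ⊕ fullPoint ⊕ singlePoints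
middle₃ 2 _ = pairPoints ⊕ fullPoint ⊕ fullPoint
middle₃ 3 _ = triplePoints ⊕ fullPoint ⊕ singlePoints
middle₃ (suc (suc (suc (suc a)))) a<4 = ⊥-elim (m+n≮m 4 a a<4)

reduce : ∀ {l} a → a < 4 * suc l → (∀ a′ → a′ < 4 * l → Middle l a′) →
  (a < 4 → Middle (suc l) a) → Middle (suc l) a
reduce {l} a a<4l below small with 4 ≤? a
... | no a≱4 = small (≰⇒> a≱4)
... | yes 4≤a with m≤n⇒∃[o]m+o≡n 4≤a
...   | a′ , refl = addPairs (below a′ (+-cancelˡ-< 4 a′ (4 * l) (subst (4 + a′ <_) (four-suc l) a<4l)))
  where
  four-suc : ∀ m → 4 * suc m ≡ 4 + 4 * m
  four-suc = solve-∀

middle : ∀ l a → 2 ≤ l → a < 4 * l → Middle l a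
middle 0 a () _
middle 1 a (s≤s ()) _
middle 2 a _ a<8 = middle₂ a a<8
middle 3 a _ a<12 = reduce a a<12 (λ a′ → middle 2 a′ (s≤s (s≤s z≤n))) (middle₃ a)
middle (suc (suc (suc (suc l)))) a _ a<4l =
  reduce a a<4l (λ a′ → middle (suc (suc (suc l))) a′ (s≤s (s≤s z≤n)))
    (λ a<4 → addTriples (middle (suc (suc l)) a (s≤s (s≤s z≤n)) (<-≤-trans a<4 (m≤m*n 4 (2 + l)))))

lower₂ : ∀ {l n} → 1 ≤ l → l + 4 ≤ n → 2 * l ≤ n → n < 6 * l → Design 4 n ((3 * n + 6 * l) / 8) l
lower₂ {suc zero} _ 5≤n _ n<6 =
  subst (λ n → Design 4 n ((3 * n + 6) / 8) 1) (≤-antisym 5≤n (≤-pred n<6)) (fullPoint ⊕ singlePoints)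
lower₂ {suc (suc l)} _ _ 2l≤n n<6l with m≤n⇒∃[o]m+o≡n 2l≤n
... | a , refl = middle (2 + l) a (s≤s (s≤s z≤n))
                   (+-cancelˡ-< (2 * (2 + l)) a (4 * (2 + l)) (subst (2 * (2 + l) + a <_) (six (2 + l)) n<6l))
  where
  six : ∀ m → 6 * m ≡ 2 * m + 4 * m
  six = solve-∀

l<value₁ : ∀ {l n} → l + 4 ≤ n → l < (n + l) / 2
l<value₁ {l} {n} l+4≤n = ≤-floor 2 (suc l) (n + l) (begin
  2 * suc l   ≤⟨ subst (2 * suc l ≤_) (slack l) (m≤m+n (2 * suc l) 2) ⟩
  l + 4 + l   ≤⟨ +-monoˡ-≤ l l+4≤n ⟩
  n + l       ∎)
  where
  open ≤-Reasoning
  slack : ∀ l → 2 * suc l + 2 ≡ l + 4 + l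
  slack = solve-∀

l<value₂ : ∀ {l n} → l + 4 ≤ n → l < (3 * n + 6 * l) / 8
l<value₂ {l} {n} l+4≤n = ≤-floor 8 (suc l) (3 * n + 6 * l) (begin
  8 * suc l             ≤⟨ subst (8 * suc l ≤_) (slack l) (m≤m+n (8 * suc l) (l + 4)) ⟩
  3 * (l + 4) + 6 * l   ≤⟨ +-monoˡ-≤ (6 * l) (*-monoʳ-≤ 3 l+4≤n) ⟩
  3 * n + 6 * l         ∎)
  where
  open ≤-Reasoning
  slack : ∀ l → 8 * suc l + (l + 4) ≡ 3 * (l + 4) + 6 * l
  slack = solve-∀

l<value₃ : ∀ {l n} → 1 ≤ l → 6 * l ≤ n → l < (n + 6 * l) / 4
l<value₃ {suc l} {n} _ 6l≤n = ≤-floor 4 (2 + l) (n + 6 * suc l) (begin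
  4 * (2 + l)               ≤⟨ subst (4 * (2 + l) ≤_) (slack l) (m≤m+n (4 * (2 + l)) (8 * l + 4)) ⟩
  6 * suc l + 6 * suc l     ≤⟨ +-monoˡ-≤ (6 * suc l) 6l≤n ⟩
  n + 6 * suc l             ∎)
  where
  open ≤-Reasoning
  slack : ∀ l → 4 * (2 + l) + (8 * l + 4) ≡ 6 * suc l + 6 * suc l
  slack = solve-∀

theorem2p4 : (l n : ℕ) → 1 ≤ l → l + 4 ≤ n →
    (n < 2 * l → IsKappa (Single l) n 4 ((n + l) / 2))
    × (2 * l ≤ n → n < 6 * l → IsKappa (Single l) n 4 ((3 * n + 6 * l) / 8))
    × (6 * l ≤ n → IsKappa (Single l) n 4 ((n + 6 * l) / 4))
theorem2p4 l n 1≤l l+4≤n =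
  (λ n<2l → realize (lower₁ l≤n n<2l) (l<value₁ l+4≤n) , λ _ → upper₁) ,
  (λ 2l≤n n<6l → realize (lower₂ 1≤l l+4≤n 2l≤n n<6l) (l<value₂ l+4≤n) , λ _ → upper₂) ,
  (λ 6l≤n → realize (lower₃ 6l≤n) (l<value₃ 1≤l 6l≤n) , λ _ → upper₃)
  where
  l≤n : l ≤ n
  l≤n = ≤-trans (m≤m+n l 4) l+4≤n
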